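{- Let $n,r,t,s$ be integers with $n/r-t$ a nonnegative integer, and let $m$ be an integer with $n\ge m>(r(r-1)(s-1)+rt)^2$ such that a Hadamard matrix of size $m$ exists. Then \[ \chi\left[KH\left(n,r,\tfrac nr-t,s\right)\right]\le 2m. \]
   Context: The generalized Kneser hypergraph $KH(n,r,k,s)$ has vertex set $\binom{[n]}{k}$ (all $k$-element subsets of $[n]=\{1,\dots,n\}$) and hyperedges all $r$-element sets $\{v_1,\dots,v_r\}$ of vertices such that $|v_i\cap v_j|<s$ for all $i\ne j$. Its chromatic number $\chi$ is the minimum number of colors in a coloring of the vertices with no monochromatic hyperedge. A Hadamard matrix of size $m$ is an $m\times m$ matrix with entries $\pm1$ whose rows are mutually orthogonal. -}

module Defs where

open import Data.Nat using (ℕ; zero; suc; _<_)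
open import Data.Fin using (Fin; zero; suc)
open import Data.Fin.Subset using (Subset; _∩_; ∣_∣)
open import Data.Integer as ℤ using (ℤ; +_; -[1+_])
open import Data.Product using (Σ; _×_; _,_)
open import Relation.Binary.PropositionalEquality using (_≡_; _≢_)
open import Relation.Nullary using (¬_)

sumℤ : (m : ℕ) → (Fin m → ℤ) → ℤ
sumℤ zero    f = + 0
sumℤ (suc m) f = f zero ℤ.+ sumℤ m (λ i → f (suc i))

IsSign : ℤ → Set
IsSign x = (x ≡ + 1) Data.Sum.⊎ (x ≡ -[1+ 0 ])
  where import Data.Sum

IsHadamard : (m : ℕ) → (Fin m → Fin m → ℤ) → Set
IsHadamard m H =
  ((i j : Fin m) → IsSign (H i j)) ×
  ((i j : Fin m) → i ≢ j → sumℤ m (λ l → H i l ℤ.* H j l) ≡ + 0)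

HadamardExists : ℕ → Set
HadamardExists m = Σ (Fin m → Fin m → ℤ) (IsHadamard m)

-- A hyperedge of KH(n,r,k,s): r distinct vertices (k-subsets of [n]),
-- indexed injectively by Fin r, with pairwise intersections of size < s.
IsHyperedge : (n r k : ℕ) (s : ℤ) → (Fin r → Subset n) → Set
IsHyperedge n r k s e =
  ((i : Fin r) → ∣ e i ∣ ≡ k) ×
  ((i j : Fin r) → i ≢ j → e i ≢ e j) ×
  ((i j : Fin r) → i ≢ j → (+ ∣ e i ∩ e j ∣) ℤ.< s)

-- a proper colouring of KH(n,r,k,s) with c colours (values on non-k-subsets irrelevant)
IsProperColoring : (n r k : ℕ) (s : ℤ) (c : ℕ) → (Subset n → Fin c) → Set
IsProperColoring n r k s c col =
  (e : Fin r → Subset n) → IsHyperedge n r k s e →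
  ¬ ((i j : Fin r) → col (e i) ≡ col (e j))

ChromaticAtMost : (n r k : ℕ) (s : ℤ) (c : ℕ) → Set
ChromaticAtMost n r k s c = Σ (Subset n → Fin c) (IsProperColoring n r k s c)

-- Colour a set A ⊆ [n] by a sign and an index i with |c_A(i)| > b, where c_A = Hᵀ w_A and
-- w_A is r·1_A − 1 restricted to the first m coordinates.  Such an i exists because
-- H Hᵀ = m I gives Σ_i c_A(i)² = m ‖w_A‖² ≥ m² > m b².  For a hyperedge e_1,…,e_r, with
-- N(l) the number of e_j containing l, Σ_j c_{e_j}(i) = r Σ_l H(l,i) (N(l) − 1), whose
-- absolute value is at most r Σ_l (N(l) − 1)² ≤ r b by double counting the pairwise
-- intersections; so the c_{e_j}(i) cannot all lie beyond b on the same side.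
module Submission where

open import Data.Bool using (true; false; if_then_else_; _∧_)
open import Data.Fin using (Fin; zero; suc; inject≤; fromℕ<; combine; _≟_)
open import Data.Fin.Properties using (any?; suc-injective; combine-injective)
open import Data.Fin.Subset using (Subset; _∩_; ∣_∣)
open import Data.Fin.Subset.Properties using (∩-idem)
open import Data.Integer as ℤ
  using (ℤ; +_; -[1+_]; +[1+_]; _+_; _*_; -_; _-_; _≤_; _<_; +≤+; -≤+; _<?_)
open import Data.Integer.Properties hiding (_≟_)
open import Data.Integer.Tactic.RingSolver using (solve-∀)
open import Data.Nat as ℕ using (ℕ; zero; suc; z≤n; s≤s)
import Data.Nat.Properties as ℕ
open import Data.Product using (Σ; _,_; proj₁; proj₂)
open import Data.Sum using (_⊎_; inj₁; inj₂)
open import Data.Vec using ([]; _∷_; lookup)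
open import Data.Vec.Properties using (lookup-zipWith)
open import Function using (_∘_)
open import Relation.Binary.PropositionalEquality
open import Relation.Nullary using (¬_; yes; no; contradiction)
open import Relation.Nullary.Decidable using (_⊎-dec_)

open import Defs

sumℤ-cong : ∀ m {f g : Fin m → ℤ} → (∀ i → f i ≡ g i) → sumℤ m f ≡ sumℤ m g
sumℤ-cong zero    f≡g = refl
sumℤ-cong (suc m) f≡g = cong₂ _+_ (f≡g zero) (sumℤ-cong m (λ i → f≡g (suc i)))

sumℤ-const : ∀ m a → sumℤ m (λ _ → a) ≡ + m * a
sumℤ-const zero    a = refl
sumℤ-const (suc m) a = begin
  a + sumℤ m (λ _ → a)  ≡⟨ cong (_+_ a) (sumℤ-const m a) ⟩
  a + + m * a           ≡⟨ cong (λ x → x + + m * a) (*-identityˡ a) ⟨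
  + 1 * a + + m * a     ≡⟨ *-distribʳ-+ a (+ 1) (+ m) ⟨
  + suc m * a           ∎
  where open ≡-Reasoning

sumℤ-zero : ∀ m → sumℤ m (λ _ → + 0) ≡ + 0
sumℤ-zero m = trans (sumℤ-const m (+ 0)) (*-zeroʳ (+ m))

sumℤ-+ : ∀ m (f g : Fin m → ℤ) → sumℤ m (λ i → f i + g i) ≡ sumℤ m f + sumℤ m g
sumℤ-+ zero    f g = refl
sumℤ-+ (suc m) f g = begin
  f zero + g zero + sumℤ m (λ i → f (suc i) + g (suc i))
    ≡⟨ cong (_+_ (f zero + g zero)) (sumℤ-+ m (λ i → f (suc i)) (λ i → g (suc i))) ⟩
  f zero + g zero + (sumℤ m (λ i → f (suc i)) + sumℤ m (λ i → g (suc i)))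
    ≡⟨ +-interchange (f zero) (g zero) _ _ ⟩
  f zero + sumℤ m (λ i → f (suc i)) + (g zero + sumℤ m (λ i → g (suc i))) ∎
  where
    open ≡-Reasoning
    +-interchange : ∀ a b c d → a + b + (c + d) ≡ a + c + (b + d)
    +-interchange = solve-∀

sumℤ-*ˡ : ∀ m a (f : Fin m → ℤ) → sumℤ m (λ i → a * f i) ≡ a * sumℤ m f
sumℤ-*ˡ zero    a f = sym (*-zeroʳ a)
sumℤ-*ˡ (suc m) a f = trans (cong (_+_ (a * f zero)) (sumℤ-*ˡ m a (λ i → f (suc i))))
                            (sym (*-distribˡ-+ a (f zero) _))

sumℤ-*ʳ : ∀ m a (f : Fin m → ℤ) → sumℤ m (λ i → f i * a) ≡ sumℤ m f * a
sumℤ-*ʳ m a f = trans (sumℤ-cong m (λ i → *-comm (f i) a)) (trans (sumℤ-*ˡ m a f) (*-comm a _))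

sumℤ-neg : ∀ m (f : Fin m → ℤ) → sumℤ m (λ i → - f i) ≡ - sumℤ m f
sumℤ-neg zero    f = refl
sumℤ-neg (suc m) f = trans (cong (_+_ (- f zero)) (sumℤ-neg m (λ i → f (suc i))))
                           (sym (neg-distrib-+ (f zero) _))

sumℤ-swap : ∀ m n (f : Fin m → Fin n → ℤ) →
  sumℤ m (λ i → sumℤ n (f i)) ≡ sumℤ n (λ j → sumℤ m (λ i → f i j))
sumℤ-swap zero    n f = sym (sumℤ-zero n)
sumℤ-swap (suc m) n f = trans (cong (_+_ (sumℤ n (f zero))) (sumℤ-swap m n (λ i → f (suc i))))
                              (sym (sumℤ-+ n (f zero) (λ j → sumℤ m (λ i → f (suc i) j))))

sumℤ-* : ∀ m n (f : Fin m → ℤ) (g : Fin n → ℤ) →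
  sumℤ m f * sumℤ n g ≡ sumℤ m (λ i → sumℤ n (λ j → f i * g j))
sumℤ-* m n f g = begin
  sumℤ m f * sumℤ n g                         ≡⟨ sumℤ-*ʳ m (sumℤ n g) f ⟨
  sumℤ m (λ i → f i * sumℤ n g)               ≡⟨ sumℤ-cong m (λ i → sumℤ-*ˡ n (f i) g) ⟨
  sumℤ m (λ i → sumℤ n (λ j → f i * g j))     ∎
  where open ≡-Reasoning

sumℤ-support : ∀ m (j : Fin m) (f : Fin m → ℤ) → (∀ i → i ≢ j → f i ≡ + 0) → sumℤ m f ≡ f j
sumℤ-support (suc m) zero f f≡0 = begin
  f zero + sumℤ m (λ i → f (suc i)) ≡⟨ cong (_+_ (f zero)) (sumℤ-cong m (λ i → f≡0 (suc i) λ ())) ⟩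
  f zero + sumℤ m (λ _ → + 0)       ≡⟨ cong (_+_ (f zero)) (sumℤ-zero m) ⟩
  f zero + + 0                      ≡⟨ +-identityʳ (f zero) ⟩
  f zero                            ∎
  where open ≡-Reasoning
sumℤ-support (suc m) (suc j) f f≡0 = begin
  f zero + sumℤ m (λ i → f (suc i)) ≡⟨ cong (_+ sumℤ m (λ i → f (suc i))) (f≡0 zero λ ()) ⟩
  + 0 + sumℤ m (λ i → f (suc i))    ≡⟨ +-identityˡ _ ⟩
  sumℤ m (λ i → f (suc i))          ≡⟨ sumℤ-support m j (λ i → f (suc i))
                                         (λ i i≢j → f≡0 (suc i) (i≢j ∘ suc-injective)) ⟩
  f (suc j)                         ∎
  where open ≡-Reasoning

sumℤ-mono-≤ : ∀ m {f g : Fin m → ℤ} → (∀ i → f i ≤ g i) → sumℤ m f ≤ sumℤ m g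
sumℤ-mono-≤ zero    f≤g = ≤-refl
sumℤ-mono-≤ (suc m) f≤g = +-mono-≤ (f≤g zero) (sumℤ-mono-≤ m (λ i → f≤g (suc i)))

sumℤ-mono-< : ∀ m {f g : Fin m → ℤ} → 1 ℕ.≤ m → (∀ i → f i < g i) → sumℤ m f < sumℤ m g
sumℤ-mono-< (suc m) _ f<g = +-mono-<-≤ (f<g zero) (sumℤ-mono-≤ m (λ i → <⇒≤ (f<g (suc i))))

sumℤ-inject≤ : ∀ m n (m≤n : m ℕ.≤ n) (f : Fin n → ℤ) → (∀ l → + 0 ≤ f l) →
  sumℤ m (λ l → f (inject≤ l m≤n)) ≤ sumℤ n f
sumℤ-inject≤ zero    n       _         f 0≤f = ≤-trans (≤-reflexive (sym (sumℤ-zero n))) (sumℤ-mono-≤ n 0≤f)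
sumℤ-inject≤ (suc m) (suc n) (s≤s m≤n) f 0≤f =
  +-monoʳ-≤ (f zero) (sumℤ-inject≤ m n m≤n (λ l → f (suc l)) (λ l → 0≤f (suc l)))

i≤+∣i∣ : ∀ i → i ≤ + ℤ.∣ i ∣
i≤+∣i∣ (+ n)    = ≤-refl
i≤+∣i∣ -[1+ n ] = -≤+

-i≤+∣i∣ : ∀ i → - i ≤ + ℤ.∣ i ∣
-i≤+∣i∣ i = ≤-trans (i≤+∣i∣ (- i)) (≤-reflexive (cong +_ (∣-i∣≡∣i∣ i)))

+∣i∣≤i*i : ∀ i → + ℤ.∣ i ∣ ≤ i * i
+∣i∣≤i*i (+ zero)  = ≤-refl
+∣i∣≤i*i +[1+ n ] = +≤+ (s≤s (ℕ.m≤m+n n _))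
+∣i∣≤i*i -[1+ n ] = +≤+ (s≤s (ℕ.m≤m+n n _))

0≤i*i : ∀ i → + 0 ≤ i * i
0≤i*i i = ≤-trans (+≤+ z≤n) (+∣i∣≤i*i i)

i*i≤j*j : ∀ {i j} → - j ≤ i → i ≤ j → i * i ≤ j * j
i*i≤j*j {i} {j} -j≤i i≤j = 0≤i-j⇒j≤i (begin
  + 0                   ≤⟨ *-monoʳ-≤-nonNeg (i + j) {{ℤ.nonNegative 0≤i+j}} (i≤j⇒0≤j-i i≤j) ⟩
  (j - i) * (i + j)     ≡⟨ difference-of-squares j i ⟩
  j * j - i * i         ∎)
  where
    open ≤-Reasoning
    0≤i+j : + 0 ≤ i + j
    0≤i+j = ≤-trans (i≤j⇒0≤j-i -j≤i) (≤-reflexive (cong (_+_ i) (neg-involutive j)))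
    difference-of-squares : ∀ a b → (a - b) * (b + a) ≡ a * a - b * b
    difference-of-squares = solve-∀

indicator : ∀ {n} → Subset n → Fin n → ℤ
indicator A l = if lookup A l then + 1 else + 0

+∣A∣≡sum-indicator : ∀ {n} (A : Subset n) → + ∣ A ∣ ≡ sumℤ n (indicator A)
+∣A∣≡sum-indicator []          = refl
+∣A∣≡sum-indicator (true ∷ A)  = cong (_+_ (+ 1)) (+∣A∣≡sum-indicator A)
+∣A∣≡sum-indicator (false ∷ A) = trans (+∣A∣≡sum-indicator A) (sym (+-identityˡ _))

indicator-∩ : ∀ {n} (A B : Subset n) l → indicator (A ∩ B) l ≡ indicator A l * indicator B l
indicator-∩ A B l rewrite lookup-zipWith _∧_ l A B with lookup A l | lookup B l
... | true  | true  = refl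
... | true  | false = refl
... | false | _     = refl

multiplicity : ∀ {n r} → (Fin r → Subset n) → Fin n → ℤ
multiplicity {r = r} e l = sumℤ r (λ j → indicator (e j) l)

sum-multiplicity : ∀ n r (e : Fin r → Subset n) →
  sumℤ n (multiplicity e) ≡ sumℤ r (λ j → + ∣ e j ∣)
sum-multiplicity n r e = trans (sumℤ-swap n r (λ l j → indicator (e j) l))
                               (sym (sumℤ-cong r (λ j → +∣A∣≡sum-indicator (e j))))

sum-multiplicity² : ∀ n r (e : Fin r → Subset n) →
  sumℤ n (λ l → multiplicity e l * multiplicity e l) ≡ sumℤ r (λ j → sumℤ r (λ j' → + ∣ e j ∩ e j' ∣))
sum-multiplicity² n r e = begin
  sumℤ n (λ l → multiplicity e l * multiplicity e l)
    ≡⟨ sumℤ-cong n (λ l → sumℤ-* r r _ _) ⟩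
  sumℤ n (λ l → sumℤ r (λ j → sumℤ r (λ j' → indicator (e j) l * indicator (e j') l)))
    ≡⟨ sumℤ-swap n r _ ⟩
  sumℤ r (λ j → sumℤ n (λ l → sumℤ r (λ j' → indicator (e j) l * indicator (e j') l)))
    ≡⟨ sumℤ-cong r (λ j → sumℤ-swap n r _) ⟩
  sumℤ r (λ j → sumℤ r (λ j' → sumℤ n (λ l → indicator (e j) l * indicator (e j') l)))
    ≡⟨ sumℤ-cong r (λ j → sumℤ-cong r (λ j' → sumℤ-cong n (λ l → indicator-∩ (e j) (e j') l))) ⟨
  sumℤ r (λ j → sumℤ r (λ j' → sumℤ n (indicator (e j ∩ e j'))))
    ≡⟨ sumℤ-cong r (λ j → sumℤ-cong r (λ j' → +∣A∣≡sum-indicator (e j ∩ e j'))) ⟨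
  sumℤ r (λ j → sumℤ r (λ j' → + ∣ e j ∩ e j' ∣)) ∎
  where open ≡-Reasoning

sumℤ²-≤ : ∀ r (f : Fin r → Fin r → ℤ) a d →
  (∀ j j' → j ≢ j' → f j j' ≤ a) → (∀ j → f j j ≤ d) →
  sumℤ r (λ j → sumℤ r (f j)) ≤ + r * (+ r * a + (d - a))
sumℤ²-≤ r f a d off-diagonal diagonal = begin
  sumℤ r (λ j → sumℤ r (f j))                         ≤⟨ sumℤ-mono-≤ r (λ j → sumℤ-mono-≤ r (f≤ j)) ⟩
  sumℤ r (λ j → sumℤ r (λ j' → a + excess j j'))    ≡⟨ sumℤ-cong r row-sum ⟩
  sumℤ r (λ _ → + r * a + (d - a))                    ≡⟨ sumℤ-const r _ ⟩
  + r * (+ r * a + (d - a))                           ∎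
  where
    open ≤-Reasoning
    excess : Fin r → Fin r → ℤ
    excess j j' with j' ≟ j
    ... | yes _ = d - a
    ... | no  _ = + 0

    excess-off : ∀ j j' → j' ≢ j → excess j j' ≡ + 0
    excess-off j j' j'≢j with j' ≟ j
    ... | yes j'≡j = contradiction j'≡j j'≢j
    ... | no  _    = refl

    excess-diag : ∀ j → excess j j ≡ d - a
    excess-diag j with j ≟ j
    ... | yes _   = refl
    ... | no  j≢j = contradiction refl j≢j

    f≤ : ∀ j j' → f j j' ≤ a + excess j j'
    f≤ j j' with j' ≟ j
    ... | yes refl = ≤-trans (diagonal j) (≤-reflexive (a+[d-a]≡d a d))
      where a+[d-a]≡d : ∀ a d → d ≡ a + (d - a)
            a+[d-a]≡d = solve-∀
    ... | no j'≢j = ≤-trans (off-diagonal j j' (j'≢j ∘ sym)) (≤-reflexive (sym (+-identityʳ a)))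

    row-sum : ∀ j → sumℤ r (λ j' → a + excess j j') ≡ + r * a + (d - a)
    row-sum j = begin-equality
      sumℤ r (λ j' → a + excess j j')          ≡⟨ sumℤ-+ r (λ _ → a) (excess j) ⟩
      sumℤ r (λ _ → a) + sumℤ r (excess j)     ≡⟨ cong₂ _+_ (sumℤ-const r a) (sumℤ-support r j (excess j) (excess-off j)) ⟩
      + r * a + excess j j                      ≡⟨ cong (_+_ (+ r * a)) (excess-diag j) ⟩
      + r * a + (d - a)                         ∎

i<j⇒i≤j-1 : ∀ {i j} → i < j → i ≤ j - + 1
i<j⇒i≤j-1 {j = j} i<j = ≤-trans (i<j⇒i≤pred[j] i<j) (≤-reflexive (+-comm ℤ.-1ℤ j))

sumℤ-[f-1]² : ∀ n (f : Fin n → ℤ) →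
  sumℤ n (λ l → (f l - + 1) * (f l - + 1)) ≡ sumℤ n (λ l → f l * f l) - + 2 * sumℤ n f + + n
sumℤ-[f-1]² n f = begin
  sumℤ n (λ l → (f l - + 1) * (f l - + 1))
    ≡⟨ sumℤ-cong n (λ l → expand (f l)) ⟩
  sumℤ n (λ l → f l * f l - + 2 * f l + + 1)
    ≡⟨ sumℤ-+ n _ _ ⟩
  sumℤ n (λ l → f l * f l - + 2 * f l) + sumℤ n (λ _ → + 1)
    ≡⟨ cong₂ _+_ (sumℤ-+ n _ _) (trans (sumℤ-const n (+ 1)) (*-identityʳ (+ n))) ⟩
  sumℤ n (λ l → f l * f l) + sumℤ n (λ l → - (+ 2 * f l)) + + n
    ≡⟨ cong (λ x → sumℤ n (λ l → f l * f l) + x + + n)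
            (trans (sumℤ-neg n _) (cong -_ (sumℤ-*ˡ n (+ 2) f))) ⟩
  sumℤ n (λ l → f l * f l) - + 2 * sumℤ n f + + n ∎
  where
    open ≡-Reasoning
    expand : ∀ x → (x - + 1) * (x - + 1) ≡ x * x - + 2 * x + + 1
    expand = solve-∀

hyperedge-deviation : ∀ {n r k s} t (e : Fin r → Subset n) → IsHyperedge n r k s e →
  + n ≡ + r * (+ k + t) →
  sumℤ n (λ l → + ℤ.∣ multiplicity e l - + 1 ∣) ≤ + r * (+ r - + 1) * (s - + 1) + + r * t
hyperedge-deviation {n} {r} {k} {s} t e (size , _ , small) n≡r[k+t] = begin
  sumℤ n (λ l → + ℤ.∣ multiplicity e l - + 1 ∣)
    ≤⟨ sumℤ-mono-≤ n (λ l → +∣i∣≤i*i (multiplicity e l - + 1)) ⟩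
  sumℤ n (λ l → (multiplicity e l - + 1) * (multiplicity e l - + 1))
    ≡⟨ sumℤ-[f-1]² n (multiplicity e) ⟩
  sumℤ n (λ l → multiplicity e l * multiplicity e l) - + 2 * sumℤ n (multiplicity e) + + n
    ≡⟨ cong₂ (λ x y → x - + 2 * y + + n) (sum-multiplicity² n r e) sum-sizes ⟩
  sumℤ r (λ j → sumℤ r (λ j' → + ∣ e j ∩ e j' ∣)) - + 2 * (+ r * + k) + + n
    ≤⟨ +-monoˡ-≤ (+ n) (+-monoˡ-≤ _ (sumℤ²-≤ r _ (s - + 1) (+ k) small-off-diagonal size-diagonal)) ⟩
  + r * (+ r * (s - + 1) + (+ k - (s - + 1))) - + 2 * (+ r * + k) + + n
    ≡⟨ cong (_+_ (+ r * (+ r * (s - + 1) + (+ k - (s - + 1))) - + 2 * (+ r * + k))) n≡r[k+t] ⟩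
  + r * (+ r * (s - + 1) + (+ k - (s - + 1))) - + 2 * (+ r * + k) + + r * (+ k + t)
    ≡⟨ simplify (+ r) (+ k) s t ⟩
  + r * (+ r - + 1) * (s - + 1) + + r * t ∎
  where
    open ≤-Reasoning
    sum-sizes : sumℤ n (multiplicity e) ≡ + r * + k
    sum-sizes = trans (sum-multiplicity n r e)
                      (trans (sumℤ-cong r (λ j → cong +_ (size j))) (sumℤ-const r (+ k)))
    small-off-diagonal : ∀ j j' → j ≢ j' → + ∣ e j ∩ e j' ∣ ≤ s - + 1
    small-off-diagonal j j' j≢j' = i<j⇒i≤j-1 (small j j' j≢j')
    size-diagonal : ∀ j → + ∣ e j ∩ e j ∣ ≤ + k
    size-diagonal j = ≤-reflexive (cong +_ (trans (cong ∣_∣ (∩-idem (e j))) (size j)))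
    simplify : ∀ r k s t → r * (r * (s - + 1) + (k - (s - + 1))) - + 2 * (r * k) + r * (k + t)
                           ≡ r * (r - + 1) * (s - + 1) + r * t
    simplify = solve-∀

IsSign-* : ∀ {x} → IsSign x → x * x ≡ + 1
IsSign-* (inj₁ refl) = refl
IsSign-* (inj₂ refl) = refl

IsSign-neg : ∀ {x} → IsSign x → IsSign (- x)
IsSign-neg (inj₁ refl) = inj₂ refl
IsSign-neg (inj₂ refl) = inj₁ refl

signed-sum-≤ : ∀ m (h x : Fin m → ℤ) → (∀ l → IsSign (h l)) →
  sumℤ m (λ l → h l * x l) ≤ sumℤ m (λ l → + ℤ.∣ x l ∣)
signed-sum-≤ m h x sign = sumℤ-mono-≤ m (λ l → signed-≤ (sign l) (x l))
  where
    signed-≤ : ∀ {h} → IsSign h → ∀ y → h * y ≤ + ℤ.∣ y ∣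
    signed-≤ (inj₁ refl) y = ≤-trans (≤-reflexive (*-identityˡ y)) (i≤+∣i∣ y)
    signed-≤ (inj₂ refl) y = ≤-trans (≤-reflexive (-1*i≡-i y)) (-i≤+∣i∣ y)

-signed-sum-≤ : ∀ m (h x : Fin m → ℤ) → (∀ l → IsSign (h l)) →
  - sumℤ m (λ l → h l * x l) ≤ sumℤ m (λ l → + ℤ.∣ x l ∣)
-signed-sum-≤ m h x sign = begin
  - sumℤ m (λ l → h l * x l)       ≡⟨ sumℤ-neg m _ ⟨
  sumℤ m (λ l → - (h l * x l))     ≡⟨ sumℤ-cong m (λ l → neg-distribˡ-* (h l) (x l)) ⟩
  sumℤ m (λ l → - h l * x l)       ≤⟨ signed-sum-≤ m (λ l → - h l) x (λ l → IsSign-neg (sign l)) ⟩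
  sumℤ m (λ l → + ℤ.∣ x l ∣)       ∎
  where open ≤-Reasoning

hadamard-parseval : ∀ m (H : Fin m → Fin m → ℤ) → IsHadamard m H → (w : Fin m → ℤ) →
  sumℤ m (λ i → sumℤ m (λ l → w l * H l i) * sumℤ m (λ l → w l * H l i))
    ≡ + m * sumℤ m (λ l → w l * w l)
hadamard-parseval m H (sign , orthogonal) w = begin
  sumℤ m (λ i → sumℤ m (λ l → w l * H l i) * sumℤ m (λ l → w l * H l i))
    ≡⟨ sumℤ-cong m (λ i → sumℤ-* m m _ _) ⟩
  sumℤ m (λ i → sumℤ m (λ l → sumℤ m (λ l' → w l * H l i * (w l' * H l' i))))
    ≡⟨ sumℤ-swap m m _ ⟩
  sumℤ m (λ l → sumℤ m (λ i → sumℤ m (λ l' → w l * H l i * (w l' * H l' i))))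
    ≡⟨ sumℤ-cong m (λ l → sumℤ-swap m m _) ⟩
  sumℤ m (λ l → sumℤ m (λ l' → sumℤ m (λ i → w l * H l i * (w l' * H l' i))))
    ≡⟨ sumℤ-cong m (λ l → sumℤ-cong m (λ l' → trans (sumℤ-cong m (λ i → regroup (w l) (H l i) (w l') (H l' i)))
                                                     (sumℤ-*ˡ m (w l * w l') _))) ⟩
  sumℤ m (λ l → sumℤ m (λ l' → w l * w l' * sumℤ m (λ i → H l i * H l' i)))
    ≡⟨ sumℤ-cong m (λ l → sumℤ-support m l _ (λ l' l'≢l → trans
         (cong (_*_ (w l * w l')) (orthogonal l l' (l'≢l ∘ sym))) (*-zeroʳ (w l * w l')))) ⟩
  sumℤ m (λ l → w l * w l * sumℤ m (λ i → H l i * H l i))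
    ≡⟨ sumℤ-cong m (λ l → cong (_*_ (w l * w l)) (row-norm l)) ⟩
  sumℤ m (λ l → w l * w l * + m)
    ≡⟨ trans (sumℤ-*ʳ m (+ m) _) (*-comm _ (+ m)) ⟩
  + m * sumℤ m (λ l → w l * w l) ∎
  where
    open ≡-Reasoning
    regroup : ∀ a h a' h' → a * h * (a' * h') ≡ a * a' * (h * h')
    regroup = solve-∀
    row-norm : ∀ l → sumℤ m (λ i → H l i * H l i) ≡ + m
    row-norm l = trans (sumℤ-cong m (λ i → IsSign-* (sign l i)))
                       (trans (sumℤ-const m (+ 1)) (*-identityʳ (+ m)))

Escapes : ℤ → ℤ → Set
Escapes b x = b < x ⊎ x < - b

side : ∀ {b x} → Escapes b x → Fin 2
side (inj₁ _) = zero
side (inj₂ _) = suc zero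

m*m≰m*x : ∀ m {x} → + 0 ≤ x → x < + m → ¬ (+ m * + m ≤ + m * x)
m*m≰m*x zero    0≤x x<0 _        = <⇒≱ x<0 0≤x
m*m≰m*x (suc m) _   x<m m*m≤m*x = <⇒≱ (*-monoˡ-<-pos (+ suc m) x<m) m*m≤m*x

escape-exists : ∀ m b (f : Fin m → ℤ) → b * b < + m → + m * + m ≤ sumℤ m (λ i → f i * f i) →
  Σ (Fin m) (λ i → Escapes b (f i))
escape-exists m b f b*b<m m*m≤∑f² with any? (λ i → (b <? f i) ⊎-dec (f i <? - b))
... | yes escape = escape
... | no  none   = contradiction m*m≤m*b*b (m*m≰m*x m (0≤i*i b) b*b<m)
  where
    open ≤-Reasoning
    m*m≤m*b*b : + m * + m ≤ + m * (b * b)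
    m*m≤m*b*b = begin
      + m * + m                 ≤⟨ m*m≤∑f² ⟩
      sumℤ m (λ i → f i * f i)  ≤⟨ sumℤ-mono-≤ m (λ i → i*i≤j*j (≮⇒≥ (none ∘ (i ,_) ∘ inj₂))
                                                               (≮⇒≥ (none ∘ (i ,_) ∘ inj₁))) ⟩
      sumℤ m (λ _ → b * b)      ≡⟨ sumℤ-const m (b * b) ⟩
      + m * (b * b)             ∎

1≤[r*1-1]² : ∀ {r} → 2 ℕ.≤ r → + 1 ≤ (+ r * + 1 - + 1) * (+ r * + 1 - + 1)
1≤[r*1-1]² (s≤s (s≤s _)) = +≤+ (s≤s z≤n)

module HadamardColouring
  {m n : ℕ} (m≤n : m ℕ.≤ n) (H : Fin m → Fin m → ℤ) (hadamard : IsHadamard m H)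
  (r : ℕ) (2≤r : 2 ℕ.≤ r) (b : ℤ) (b*b<m : b * b < + m) where

  weight : Subset n → Fin m → ℤ
  weight A l = + r * indicator A (inject≤ l m≤n) - + 1

  coefficient : Subset n → Fin m → ℤ
  coefficient A i = sumℤ m (λ l → weight A l * H l i)

  1≤weight² : ∀ A l → + 1 ≤ weight A l * weight A l
  1≤weight² A l with lookup A (inject≤ l m≤n)
  ... | true                        = 1≤[r*1-1]² 2≤r
  ... | false rewrite *-zeroʳ (+ r) = ≤-refl

  m*m≤∑coefficient² : ∀ A → + m * + m ≤ sumℤ m (λ i → coefficient A i * coefficient A i)
  m*m≤∑coefficient² A = begin
    + m * + m                                       ≡⟨ cong (_*_ (+ m)) (trans (sumℤ-const m (+ 1)) (*-identityʳ (+ m))) ⟨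
    + m * sumℤ m (λ _ → + 1)                        ≤⟨ *-monoˡ-≤-nonNeg (+ m) (sumℤ-mono-≤ m (1≤weight² A)) ⟩
    + m * sumℤ m (λ l → weight A l * weight A l)    ≡⟨ hadamard-parseval m H hadamard (weight A) ⟨
    sumℤ m (λ i → coefficient A i * coefficient A i) ∎
    where open ≤-Reasoning

  escape : ∀ A → Σ (Fin m) (λ i → Escapes b (coefficient A i))
  escape A = escape-exists m b (coefficient A) b*b<m (m*m≤∑coefficient² A)

  encode : ∀ {A} → Σ (Fin m) (λ i → Escapes b (coefficient A i)) → Fin (2 ℕ.* m)
  encode (i , escapes) = combine (side escapes) i

  colour : Subset n → Fin (2 ℕ.* m)
  colour A = encode {A} (escape A)

  above-if-encoded : ∀ {A} i (p : Σ (Fin m) (λ i → Escapes b (coefficient A i))) →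
    encode {A} p ≡ combine {2} {m} zero i → b < coefficient A i
  above-if-encoded {A} i (i' , inj₁ b<c) same =
    subst (λ i → b < coefficient A i) (proj₂ (combine-injective {2} {m} zero i' zero i same)) b<c
  above-if-encoded i (i' , inj₂ _) same with () ← proj₁ (combine-injective {2} {m} (suc zero) i' zero i same)

  below-if-encoded : ∀ {A} i (p : Σ (Fin m) (λ i → Escapes b (coefficient A i))) →
    encode {A} p ≡ combine {2} {m} (suc zero) i → coefficient A i < - b
  below-if-encoded {A} i (i' , inj₂ c<-b) same =
    subst (λ i → coefficient A i < - b) (proj₂ (combine-injective {2} {m} (suc zero) i' (suc zero) i same)) c<-b
  below-if-encoded i (i' , inj₁ _) same with () ← proj₁ (combine-injective {2} {m} zero i' (suc zero) i same)

  deviation : (Fin r → Subset n) → Fin m → ℤ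
  deviation e l = multiplicity e (inject≤ l m≤n) - + 1

  sum-coefficient : (e : Fin r → Subset n) (i : Fin m) →
    sumℤ r (λ j → coefficient (e j) i) ≡ + r * sumℤ m (λ l → H l i * deviation e l)
  sum-coefficient e i = begin
    sumℤ r (λ j → sumℤ m (λ l → weight (e j) l * H l i))   ≡⟨ sumℤ-swap r m _ ⟩
    sumℤ m (λ l → sumℤ r (λ j → weight (e j) l * H l i))   ≡⟨ sumℤ-cong m column ⟩
    sumℤ m (λ l → + r * (H l i * deviation e l))           ≡⟨ sumℤ-*ˡ m (+ r) _ ⟩
    + r * sumℤ m (λ l → H l i * deviation e l)             ∎
    where
      open ≡-Reasoning
      factor : ∀ r N h → (r * N + r * - + 1) * h ≡ r * (h * (N - + 1))
      factor = solve-∀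
      column : ∀ l → sumℤ r (λ j → weight (e j) l * H l i) ≡ + r * (H l i * deviation e l)
      column l = begin
        sumℤ r (λ j → weight (e j) l * H l i)                            ≡⟨ sumℤ-*ʳ r (H l i) _ ⟩
        sumℤ r (λ j → + r * indicator (e j) (inject≤ l m≤n) - + 1) * H l i
          ≡⟨ cong (_* H l i) (trans (sumℤ-+ r _ _)
                (cong₂ _+_ (sumℤ-*ˡ r (+ r) _) (sumℤ-const r (- + 1)))) ⟩
        (+ r * multiplicity e (inject≤ l m≤n) + + r * - + 1) * H l i     ≡⟨ factor (+ r) _ (H l i) ⟩
        + r * (H l i * deviation e l)                                    ∎

  1≤r : 1 ℕ.≤ r
  1≤r = ℕ.≤-trans (s≤s z≤n) 2≤r

  module _ (e : Fin r → Subset n) (small-deviation : sumℤ n (λ l → + ℤ.∣ multiplicity e l - + 1 ∣) ≤ b) where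

    ∑∣deviation∣≤b : sumℤ m (λ l → + ℤ.∣ deviation e l ∣) ≤ b
    ∑∣deviation∣≤b = ≤-trans (sumℤ-inject≤ m n m≤n _ (λ _ → +≤+ z≤n)) small-deviation

    X≤b : ∀ i → sumℤ m (λ l → H l i * deviation e l) ≤ b
    X≤b i = ≤-trans (signed-sum-≤ m (λ l → H l i) (deviation e) (λ l → proj₁ hadamard l i)) ∑∣deviation∣≤b

    -b≤X : ∀ i → - b ≤ sumℤ m (λ l → H l i * deviation e l)
    -b≤X i = ≤-trans (neg-mono-≤ (≤-trans (-signed-sum-≤ m (λ l → H l i) (deviation e) (λ l → proj₁ hadamard l i))
                                          ∑∣deviation∣≤b))
                     (≤-reflexive (neg-involutive _))

    not-all-above : ∀ i → ¬ (∀ j → b < coefficient (e j) i)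
    not-all-above i above = <-irrefl refl (begin-strict
      + r * b                                            ≡⟨ sumℤ-const r b ⟨
      sumℤ r (λ _ → b)                                   <⟨ sumℤ-mono-< r 1≤r above ⟩
      sumℤ r (λ j → coefficient (e j) i)                 ≡⟨ sum-coefficient e i ⟩
      + r * sumℤ m (λ l → H l i * deviation e l)         ≤⟨ *-monoˡ-≤-nonNeg (+ r) (X≤b i) ⟩
      + r * b                                            ∎)
      where open ≤-Reasoning

    not-all-below : ∀ i → ¬ (∀ j → coefficient (e j) i < - b)
    not-all-below i below = <-irrefl refl (begin-strict
      + r * sumℤ m (λ l → H l i * deviation e l)         ≡⟨ sum-coefficient e i ⟨
      sumℤ r (λ j → coefficient (e j) i)                 <⟨ sumℤ-mono-< r 1≤r below ⟩
      sumℤ r (λ _ → - b)                                 ≡⟨ sumℤ-const r (- b) ⟩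
      + r * - b                                          ≤⟨ *-monoˡ-≤-nonNeg (+ r) (-b≤X i) ⟩
      + r * sumℤ m (λ l → H l i * deviation e l)         ∎)
      where open ≤-Reasoning

    not-monochromatic : ∀ {A} (p : Σ (Fin m) (λ i → Escapes b (coefficient A i))) →
      ¬ (∀ j → colour (e j) ≡ encode {A} p)
    not-monochromatic (i , inj₁ _) same =
      not-all-above i (λ j → above-if-encoded {e j} i (escape (e j)) (same j))
    not-monochromatic (i , inj₂ _) same =
      not-all-below i (λ j → below-if-encoded {e j} i (escape (e j)) (same j))

  colour-proper : ∀ k s →
    (∀ e → IsHyperedge n r k s e → sumℤ n (λ l → + ℤ.∣ multiplicity e l - + 1 ∣) ≤ b) →
    IsProperColoring n r k s (2 ℕ.* m) colour
  colour-proper k s small-deviation e hyperedge same-colour =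
    not-monochromatic e (small-deviation e hyperedge) {e j₀} (escape (e j₀)) (λ j → same-colour j j₀)
    where
      j₀ : Fin r
      j₀ = fromℕ< 1≤r

theorem3 : (n r m k : ℕ) (t s : ℤ) →
    2 ℕ.≤ r →
    + n ≡ + r ℤ.* (+ k ℤ.+ t) →
    m ℕ.≤ n →
    let b = + r ℤ.* (+ r ℤ.- + 1) ℤ.* (s ℤ.- + 1) ℤ.+ + r ℤ.* t in
    b ℤ.* b ℤ.< + m →
    HadamardExists m →
    ChromaticAtMost n r k s (2 ℕ.* m)
theorem3 n r m k t s 2≤r n≡r[k+t] m≤n b*b<m (H , hadamard) =
  colour , colour-proper k s (λ e hyperedge → hyperedge-deviation t e hyperedge n≡r[k+t])
  where open HadamardColouring m≤n H hadamard r 2≤r (+ r * (+ r - + 1) * (s - + 1) + + r * t) b*b<m
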